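{- Let $\lambda=(4,4)$. The clique number of the isotopy graph $\mathscr{G}(\lambda)$ is $4$.
   Context: A Latin tableau of shape $(4,4)$ is a $2\times 4$ array whose two rows are each permutations of $1,2,3,4$ and whose two entries in each column are distinct. Elementary transformations: $r_{(1,2)}$ interchanges the two rows; $c_{(i,j)}$ interchanges columns $i$ and $j$; $s_{(x,y)}$ replaces every entry $x$ by $y$ and vice versa. The isotopy graph $\mathscr{G}(\lambda)$ has as vertices all Latin tableaux of shape $\lambda$; two distinct vertices are adjacent (by a single edge) if one is obtained from the other by one elementary transformation. The clique number is the maximum size of a set of pairwise adjacent vertices. -}

module Defs where

open import Data.Nat using (ℕ; _≤_)
open import Data.Fin using (Fin)
open import Data.Fin.Properties using (_≟_)
open import Data.Vec using (Vec; lookup; map; tabulate)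
open import Data.Product using (_×_; _,_; ∃-syntax)
open import Data.List using (List; length)
open import Data.List.Relation.Unary.All using (All)
open import Data.List.Relation.Unary.AllPairs using (AllPairs)
open import Relation.Nullary using (¬_; yes; no)
open import Relation.Binary.PropositionalEquality using (_≡_; _≢_)

-- Symbols 1,2,3,4 are represented by Fin 4; columns are indexed by Fin 4.
Row : Set
Row = Vec (Fin 4) 4

Array : Set
Array = Row × Row

-- A row is a permutation of the 4 symbols: its 4 entries are pairwise distinct
-- (an injective map Fin 4 → Fin 4, i.e. a bijection).
IsPermRow : Row → Set
IsPermRow r = ∀ i j → lookup r i ≡ lookup r j → i ≡ j

IsLatinTableau : Array → Set
IsLatinTableau (a , b) =
  IsPermRow a × IsPermRow b × (∀ i → lookup a i ≢ lookup b i)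

swapFin : ∀ {n} → Fin n → Fin n → Fin n → Fin n
swapFin x y k with k ≟ x
... | yes _ = y
... | no _ with k ≟ y
...   | yes _ = x
...   | no _ = k

data Elementary : Set where
  r₁₂ : Elementary
  c : Fin 4 → Fin 4 → Elementary
  s : Fin 4 → Fin 4 → Elementary

swapColumns : Fin 4 → Fin 4 → Row → Row
swapColumns i j r = tabulate (λ k → lookup r (swapFin i j k))

apply : Elementary → Array → Array
apply r₁₂ (a , b) = (b , a)
apply (c i j) (a , b) = (swapColumns i j a , swapColumns i j b)
apply (s x y) (a , b) = (map (swapFin x y) a , map (swapFin x y) b)

Adjacent : Array → Array → Set
Adjacent T U = T ≢ U × ∃[ e ] apply e T ≡ U

IsClique : List Array → Set
IsClique L = All IsLatinTableau L × AllPairs Adjacent L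

CliqueNumber≡ : ℕ → Set
CliqueNumber≡ k =
  (∃[ L ] (IsClique L × length L ≡ k)) × (∀ L → IsClique L → length L ≤ k)

module Submission where

-- Colour a tableau (a , b) by the parity of the number of inversions of its
-- first row.  For a Latin tableau, swapping two distinct columns or two
-- distinct symbols is a transposition of the first row, so it changes the
-- colour; the degenerate swaps c_(i,i) and s_(i,i) fix every tableau and so
-- produce no edge.  Hence every monochromatic edge of 𝒢((4,4)) is a row
-- interchange r_(1,2), i.e. joins T to the single tableau obtained from T by
-- exchanging its rows.
--
-- A purely graph-theoretic lemma (module TwoColouring) then finishes the upper
-- bound: if vertices are 2-coloured and every monochromatic edge leaving x goes
-- to one fixed partner of x, a clique has at most two vertices of each colour,
-- hence at most four.  The bound is attained by four explicit tableaux which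
-- are pairwise related by r_(1,2), c_(1,2) or c_(3,4).

open import Defs
open import Data.Nat using (ℕ; _≤_; _+_; z≤n; s≤s; _<ᵇ_)
open import Data.Nat.Properties using (+-suc; +-mono-≤; module ≤-Reasoning)
open import Data.Bool using (Bool; true; false; _xor_)
import Data.Bool.Properties as Bool
open import Data.Fin using (Fin; zero; suc; toℕ)
open import Data.Fin.Properties using (_≟_; all?)
open import Data.Vec using ([]; _∷_; lookup; map)
open import Data.Vec.Properties using (tabulate∘lookup; map-id; map-cong; tabulate-cong)
open import Data.Product using (_×_; _,_; proj₁)
open import Data.Empty using (⊥-elim)
open import Data.List using (List; []; _∷_; length; filter)
open import Data.List.Relation.Unary.All as All using (All; []; _∷_)
open import Data.List.Relation.Unary.All.Properties using (all-filter)
open import Data.List.Relation.Unary.AllPairs using (AllPairs; []; _∷_)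
import Data.List.Relation.Unary.AllPairs.Properties as AllPairs
open import Relation.Nullary using (Dec; yes; no; ¬?)
open import Relation.Nullary.Decidable using (True; toWitness; from-yes; map′; _→-dec_; _×-dec_)
open import Relation.Binary.PropositionalEquality
  using (_≡_; _≢_; refl; sym; trans; cong; cong₂)

module TwoColouring {V : Set} (colour : V → Bool) (partner : V → V) where

  Compatible : V → V → Set
  Compatible x y = x ≢ y × (colour x ≡ colour y → y ≡ partner x)

  -- Vertices of one colour that are pairwise compatible number at most two:
  -- a third one would be a second, distinct, partner of the first.
  monochromatic-≤2 : ∀ {b} L → All (λ x → colour x ≡ b) L →
                     AllPairs Compatible L → length L ≤ 2
  monochromatic-≤2 [] _ _ = z≤n
  monochromatic-≤2 (_ ∷ []) _ _ = s≤s z≤n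
  monochromatic-≤2 (_ ∷ _ ∷ []) _ _ = s≤s (s≤s z≤n)
  monochromatic-≤2 (_ ∷ _ ∷ _ ∷ _) (cx ∷ cy ∷ cz ∷ _)
                   (((_ , xy) ∷ (_ , xz) ∷ _) ∷ ((y≢z , _) ∷ _) ∷ _) =
    ⊥-elim (y≢z (trans (xy (trans cx (sym cy))) (sym (xz (trans cx (sym cz))))))

  hasColour? : (b : Bool) (x : V) → Dec (colour x ≡ b)
  hasColour? b x = colour x Bool.≟ b

  ofColour : Bool → List V → List V
  ofColour b = filter (hasColour? b)

  length-byColour : ∀ L → length L ≡ length (ofColour true L) + length (ofColour false L)
  length-byColour [] = refl
  length-byColour (x ∷ L) with colour x
  ... | true  = cong ℕ.suc (length-byColour L)
  ... | false = trans (cong ℕ.suc (length-byColour L)) (sym (+-suc _ _))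

  compatible-≤4 : ∀ L → AllPairs Compatible L → length L ≤ 4
  compatible-≤4 L compat = begin
    length L                                              ≡⟨ length-byColour L ⟩
    length (ofColour true L) + length (ofColour false L)  ≤⟨ +-mono-≤ (class-≤2 true) (class-≤2 false) ⟩
    4                                                     ∎
    where
    open ≤-Reasoning
    class-≤2 : ∀ b → length (ofColour b L) ≤ 2
    class-≤2 b = monochromatic-≤2 (ofColour b L) (all-filter (hasColour? b) L)
                                  (AllPairs.filter⁺ (hasColour? b) compat)

inversion : Fin 4 → Fin 4 → Bool
inversion x y = toℕ y <ᵇ toℕ x

parity : Row → Bool
parity (a₀ ∷ a₁ ∷ a₂ ∷ a₃ ∷ []) =
  inversion a₀ a₁ xor inversion a₀ a₂ xor inversion a₀ a₃ xor
  inversion a₁ a₂ xor inversion a₁ a₃ xor inversion a₂ a₃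

isPermRow? : (a : Row) → Dec (IsPermRow a)
isPermRow? a = all? λ i → all? λ j → (lookup a i ≟ lookup a j) →-dec (i ≟ j)

allRows? : {Q : Row → Set} → ((a : Row) → Dec (Q a)) → Dec (∀ a → Q a)
allRows? Q? =
  map′ (λ h → λ { (x₀ ∷ x₁ ∷ x₂ ∷ x₃ ∷ []) → h x₀ x₁ x₂ x₃ }) (λ h _ _ _ _ → h _)
       (all? λ x₀ → all? λ x₁ → all? λ x₂ → all? λ x₃ → Q? (x₀ ∷ x₁ ∷ x₂ ∷ x₃ ∷ []))

FlipsParity : (Fin 4 → Fin 4 → Row → Row) → Set
FlipsParity t = ∀ a i j → IsPermRow a → i ≢ j → parity (t i j a) ≢ parity a

flipsParity? : ∀ t → Dec (FlipsParity t)
flipsParity? t = allRows? λ a → all? λ i → all? λ j →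
  isPermRow? a →-dec (¬? (i ≟ j) →-dec ¬? (parity (t i j a) Bool.≟ parity a))

swapSymbols : Fin 4 → Fin 4 → Row → Row
swapSymbols x y = map (swapFin x y)

swapColumns-flipsParity : FlipsParity swapColumns
swapColumns-flipsParity = from-yes (flipsParity? swapColumns)

swapSymbols-flipsParity : FlipsParity swapSymbols
swapSymbols-flipsParity = from-yes (flipsParity? swapSymbols)

-- The degenerate transposition (i i) is the identity (both tests in swapFin
-- compare k with i) ...
swapFin-self : ∀ {n} (i k : Fin n) → swapFin i i k ≡ k
swapFin-self i k with k ≟ i
... | yes k≡i = sym k≡i
... | no _ with k ≟ i
...   | yes k≡i = sym k≡i
...   | no _ = refl

swapColumns-self : ∀ i a → swapColumns i i a ≡ a
swapColumns-self i a =
  trans (tabulate-cong (λ k → cong (lookup a) (swapFin-self i k))) (tabulate∘lookup a)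

swapSymbols-self : ∀ x a → swapSymbols x x a ≡ a
swapSymbols-self x a = trans (map-cong (swapFin-self x) a) (map-id a)

colour : Array → Bool
colour (a , _) = parity a

swapRows : Array → Array
swapRows (a , b) = (b , a)

open TwoColouring colour swapRows using (Compatible; compatible-≤4)

monochromaticEdge : ∀ {a b U} → IsPermRow a → Adjacent (a , b) U →
                    colour (a , b) ≡ colour U → U ≡ (b , a)
monochromaticEdge _ (_ , r₁₂ , refl) _ = refl
monochromaticEdge {a} {b} perm (T≢U , c i j , refl) same with i ≟ j
... | yes refl = ⊥-elim (T≢U (sym (cong₂ _,_ (swapColumns-self i a) (swapColumns-self i b))))
... | no i≢j = ⊥-elim (swapColumns-flipsParity a i j perm i≢j (sym same))
monochromaticEdge {a} {b} perm (T≢U , s x y , refl) same with x ≟ y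
... | yes refl = ⊥-elim (T≢U (sym (cong₂ _,_ (swapSymbols-self x a) (swapSymbols-self x b))))
... | no x≢y = ⊥-elim (swapSymbols-flipsParity a x y perm x≢y (sym same))

adjacent⇒compatible : ∀ {T U} → IsLatinTableau T → Adjacent T U → Compatible T U
adjacent⇒compatible {_ , _} (perm , _) adj = proj₁ adj , monochromaticEdge perm adj

clique⇒compatible : ∀ {L} → All IsLatinTableau L → AllPairs Adjacent L → AllPairs Compatible L
clique⇒compatible [] [] = []
clique⇒compatible (latin ∷ latins) (adjs ∷ adjss) =
  All.map (adjacent⇒compatible latin) adjs ∷ clique⇒compatible latins adjss

clique-≤4 : ∀ L → IsClique L → length L ≤ 4
clique-≤4 L (latins , adjs) = compatible-≤4 L (clique⇒compatible latins adjs)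

isLatinTableau? : ∀ T → Dec (IsLatinTableau T)
isLatinTableau? (a , b) =
  isPermRow? a ×-dec (isPermRow? b ×-dec all? (λ i → ¬? (lookup a i ≟ lookup b i)))

pattern 𝟏 = zero
pattern 𝟐 = suc zero
pattern 𝟑 = suc (suc zero)
pattern 𝟒 = suc (suc (suc zero))

A B C D : Array
A = (𝟏 ∷ 𝟐 ∷ 𝟑 ∷ 𝟒 ∷ []) , (𝟐 ∷ 𝟏 ∷ 𝟒 ∷ 𝟑 ∷ [])
B = (𝟏 ∷ 𝟐 ∷ 𝟒 ∷ 𝟑 ∷ []) , (𝟐 ∷ 𝟏 ∷ 𝟑 ∷ 𝟒 ∷ [])
C = (𝟐 ∷ 𝟏 ∷ 𝟑 ∷ 𝟒 ∷ []) , (𝟏 ∷ 𝟐 ∷ 𝟒 ∷ 𝟑 ∷ [])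
D = (𝟐 ∷ 𝟏 ∷ 𝟒 ∷ 𝟑 ∷ []) , (𝟏 ∷ 𝟐 ∷ 𝟑 ∷ 𝟒 ∷ [])

clique-ABCD : IsClique (A ∷ B ∷ C ∷ D ∷ [])
clique-ABCD =
  (latin A ∷ latin B ∷ latin C ∷ latin D ∷ []) ,
  (((λ ()) , c 𝟑 𝟒 , refl) ∷ ((λ ()) , c 𝟏 𝟐 , refl) ∷ ((λ ()) , r₁₂ , refl) ∷ []) ∷
  (((λ ()) , r₁₂ , refl) ∷ ((λ ()) , c 𝟏 𝟐 , refl) ∷ []) ∷
  (((λ ()) , c 𝟑 𝟒 , refl) ∷ []) ∷ [] ∷ []
  where
  latin : ∀ T {_ : True (isLatinTableau? T)} → IsLatinTableau T
  latin T {certificate} = toWitness certificate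

lemma3p3 : CliqueNumber≡ 4
lemma3p3 = ((A ∷ B ∷ C ∷ D ∷ []) , clique-ABCD , refl) , clique-≤4
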